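{- Let $\mathcal{A}=\langle\Sigma,Q,q_0,\delta,\alpha\rangle$ be a nice GFG-tNCW and let $\mathcal{E}\subseteq(Q\times\Sigma\times Q)\setminus\Delta$ be an allowed set. Let $p,s\in Q$ with $L(\mathcal{A}^p)=L(\mathcal{A}^s)$. Then $\mathcal{A}_\mathcal{E}^s$ is a GFG-tNCW and $L(\mathcal{A}_\mathcal{E}^s)=L(\mathcal{A}^p)$.
   Context: A tNCW is $\mathcal{A}=\langle \Sigma,Q,q_0,\delta,\alpha\rangle$ with finite alphabet $\Sigma$, finite state set $Q$, initial state $q_0$, total transition function $\delta:Q\times\Sigma\to 2^Q\setminus\{\emptyset\}$ with transition relation $\Delta=\{\langle q,\sigma,s\rangle: s\in\delta(q,\sigma)\}$, and $\alpha\subseteq\Delta$ ($\alpha$-transitions; the rest are $\bar\alpha$-transitions); $\delta^{\bar\alpha}(q,\sigma)$ is the set of $\sigma$-successors of $q$ via $\bar\alpha$-transitions. A run on $w=\sigma_1\sigma_2\cdots$ is $r_0r_1\cdots$ with $r_0=q_0$, $r_{i+1}\in\delta(r_i,\sigma_{i+1})$, accepting iff it traverses $\alpha$-transitions only finitely often. $\mathcal{A}^q$ is $\mathcal{A}$ with initial state $q$. $\mathcal{A}$ is GFG if there is $f:\Sigma^*\to Q$ with $f(\epsilon)=q_0$, $\langle f(u),\sigma,f(u\sigma)\rangle\in\Delta$ for all $u,\sigma$, and for every $w\in L(\mathcal{A})$ the run $f(w[1,0]),f(w[1,1]),\dots$ is accepting; a state $q$ is GFG if $\mathcal{A}^q$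 is. $q\sim s$ iff $L(\mathcal{A}^q)=L(\mathcal{A}^s)$. $\mathcal{A}$ is semantically deterministic if any two $\sigma$-successors of a state are $\sim$-equivalent; safe deterministic if $|\delta^{\bar\alpha}(q,\sigma)|\le1$; normal if a path of $\bar\alpha$-transitions from $q$ to $s$ implies one from $s$ to $q$. A GFG-tNCW is nice if all states are reachable and GFG and it is normal, safe deterministic and semantically deterministic. A triple $\langle q,\sigma,s\rangle\in Q\times\Sigma\times Q$ is an allowed transition if there is $s'\in Q$ with $s\sim s'$ and $\langle q,\sigma,s'\rangle\in\Delta$. A set $\mathcal{E}\subseteq(Q\times\Sigma\times Q)\setminus\Delta$ is an allowed set if all its triples are allowed transitions. $\mathcal{A}_\mathcal{E}$ is the tNCW with the same $\Sigma,Q,q_0$, transition relation $\Delta\cup\mathcal{E}$ and acceptance condition $\alpha\cup\mathcal{E}$; $\mathcal{A}_\mathcal{E}^s$ is it with initial state $s$. -}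

module Defs where

open import Data.Nat using (ℕ; zero; suc; _≤_)
open import Data.Fin using (Fin)
open import Data.Bool using (Bool; true; false; T; _∨_; not)
open import Data.Unit using (⊤)
open import Data.Empty using (⊥)
open import Data.Sum using (_⊎_; inj₁; inj₂)
open import Data.List using (List; []; _∷_; _∷ʳ_)
open import Data.Product using (Σ; _×_; _,_; ∃; ∃-syntax; proj₁; proj₂)
open import Relation.Nullary using (¬_)
open import Relation.Binary.PropositionalEquality using (_≡_)

-- Alphabet Σ = Fin k, state set Q = Fin n (finite).  Sets of transitions are
-- Boolean-valued predicates on Q × Σ × Q.
-- Infinite words are functions ℕ → Σ (letter σ_{i+1} is  w i).

record TNCW (k n : ℕ) : Set where
  field
    q₀    : Fin n
    Δ     : Fin n → Fin k → Fin n → Bool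
    α     : Fin n → Fin k → Fin n → Bool
    total : ∀ q σ → ∃[ s ] T (Δ q σ s)
    α⊆Δ   : ∀ q σ s → T (α q σ s) → T (Δ q σ s)
open TNCW public

∨-introˡ : ∀ {a} b → T a → T (a ∨ b)
∨-introˡ {true} b t = t

∨-introʳ : ∀ a b → T b → T (a ∨ b)
∨-introʳ true  b t = _
∨-introʳ false b t = t

module _ {k n : ℕ} where

  _^_ : TNCW k n → Fin n → TNCW k n
  A ^ q = record { q₀ = q ; Δ = Δ A ; α = α A ; total = total A ; α⊆Δ = α⊆Δ A }

  IsRun : TNCW k n → (ℕ → Fin k) → (ℕ → Fin n) → Set
  IsRun A w r = (r 0 ≡ q₀ A) × (∀ i → T (Δ A (r i) (w i) (r (suc i))))

  Accepting : TNCW k n → (ℕ → Fin k) → (ℕ → Fin n) → Set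
  Accepting A w r = ∃[ N ] (∀ i → N ≤ i → ¬ T (α A (r i) (w i) (r (suc i))))

  Lang : TNCW k n → (ℕ → Fin k) → Set
  Lang A w = ∃[ r ] (IsRun A w r × Accepting A w r)

  SameLang : TNCW k n → TNCW k n → Set
  SameLang A B = ∀ w → (Lang A w → Lang B w) × (Lang B w → Lang A w)

  Equiv : TNCW k n → Fin n → Fin n → Set
  Equiv A q s = SameLang (A ^ q) (A ^ s)

  prefix : (ℕ → Fin k) → ℕ → List (Fin k)
  prefix w zero    = []
  prefix w (suc i) = prefix w i ∷ʳ w i

  IsStrategy : TNCW k n → (List (Fin k) → Fin n) → Set
  IsStrategy A f =
    (f [] ≡ q₀ A) ×
    (∀ u σ → T (Δ A (f u) σ (f (u ∷ʳ σ)))) ×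
    (∀ w → Lang A w → Accepting A w (λ i → f (prefix w i)))

  GFG : TNCW k n → Set
  GFG A = ∃[ f ] IsStrategy A f

  GFGState : TNCW k n → Fin n → Set
  GFGState A q = GFG (A ^ q)

  data PathVia (A : TNCW k n) (P : Fin n → Fin k → Fin n → Set) : Fin n → Fin n → Set where
    here : ∀ {q} → PathVia A P q q
    step : ∀ {q σ s t} → T (Δ A q σ s) → P q σ s → PathVia A P s t → PathVia A P q t

  NotAlpha : TNCW k n → Fin n → Fin k → Fin n → Set
  NotAlpha A q σ s = ¬ T (α A q σ s)

  Reachable : TNCW k n → Fin n → Set
  Reachable A q = PathVia A (λ _ _ _ → ⊤) (q₀ A) q

  SemDet : TNCW k n → Set
  SemDet A = ∀ q σ s s' → T (Δ A q σ s) → T (Δ A q σ s') → Equiv A s s'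

  SafeDet : TNCW k n → Set
  SafeDet A = ∀ q σ s s' → T (Δ A q σ s) → NotAlpha A q σ s
                         → T (Δ A q σ s') → NotAlpha A q σ s' → s ≡ s'

  Normal : TNCW k n → Set
  Normal A = ∀ q s → PathVia A (NotAlpha A) q s → PathVia A (NotAlpha A) s q

  Nice : TNCW k n → Set
  Nice A = GFG A × (∀ q → Reachable A q) × (∀ q → GFGState A q)
         × Normal A × SafeDet A × SemDet A

  Allowed : TNCW k n → Fin n → Fin k → Fin n → Set
  Allowed A q σ s = ∃[ s' ] (Equiv A s s' × T (Δ A q σ s'))

  AllowedSet : TNCW k n → (Fin n → Fin k → Fin n → Bool) → Set
  AllowedSet A E = ∀ q σ s → T (E q σ s) → ¬ T (Δ A q σ s) × Allowed A q σ s

  extend : TNCW k n → (Fin n → Fin k → Fin n → Bool) → TNCW k n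
  extend A E = record
    { q₀ = q₀ A
    ; Δ = λ q σ s → Δ A q σ s ∨ E q σ s
    ; α = λ q σ s → α A q σ s ∨ E q σ s
    ; total = λ q σ → proj₁ (total A q σ) , ∨-introˡ (E q σ (proj₁ (total A q σ))) (proj₂ (total A q σ))
    ; α⊆Δ = λ q σ s → lem (α A q σ s) (Δ A q σ s) (E q σ s) (α⊆Δ A q σ s)
    }
    where
    lem : ∀ a d e → (T a → T d) → T (a ∨ e) → T (d ∨ e)
    lem true  true  e h t = t
    lem true  false e h t with h t
    ... | ()
    lem false d     e h t = ∨-introʳ d e t

module Submission where

-- Idea: an ℰ-transition is an α-transition of 𝒜_ℰ, so an accepting run of 𝒜_ℰ uses only
-- finitely many of them; each one ⟨q,σ,t⟩ can be replaced by an 𝒜-transition ⟨q,σ,t'⟩ with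
-- t ∼ t', working backwards from the last one, so L(𝒜_ℰ^s) ⊆ L(𝒜^s).  Conversely 𝒜 ⊆ 𝒜_ℰ,
-- and as ℰ ∩ Δ = ∅ the two automata agree on which 𝒜-transitions lie in α.  Hence
-- L(𝒜_ℰ^s) = L(𝒜^s) = L(𝒜^p), and a GFG strategy of 𝒜^s is one of 𝒜_ℰ^s as well.

open import Defs
open import Data.Nat using (ℕ; zero; suc; _≤_; z≤n; s≤s)
open import Data.Fin using (Fin)
open import Data.Bool using (Bool; T)
open import Data.Bool.Properties using (T-∨)
open import Data.Product using (_×_; _,_; proj₁; proj₂)
open import Data.Sum using (inj₁; inj₂)
open import Data.Empty using (⊥-elim)
open import Function using (_∘_; _∘₂_)
open import Function.Bundles using (Equivalence)
open import Relation.Nullary using (¬_)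
open import Relation.Binary.PropositionalEquality using (refl; subst; sym)

module _ {k n : ℕ} where

  Steps : TNCW k n → (ℕ → Fin k) → (ℕ → Fin n) → Set
  Steps A w r = ∀ i → T (Δ A (r i) (w i) (r (suc i)))

  SafeFrom : TNCW k n → ℕ → (ℕ → Fin k) → (ℕ → Fin n) → Set
  SafeFrom A N w r = ∀ i → N ≤ i → ¬ T (α A (r i) (w i) (r (suc i)))

  Lang-∷ : ∀ (A : TNCW k n) {q t} w → T (Δ A q (w 0) t) → Lang (A ^ t) (w ∘ suc) → Lang (A ^ q) w
  Lang-∷ A {q} w q→t (r , (r₀ , steps) , N , safe) = run , (refl , steps′) , suc N , safe′
    where
    run : ℕ → Fin n
    run zero    = q
    run (suc i) = r i

    steps′ : Steps A w run
    steps′ zero    = subst (T ∘ Δ A q (w 0)) (sym r₀) q→t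
    steps′ (suc i) = steps i

    safe′ : SafeFrom A (suc N) w run
    safe′ (suc i) (s≤s N≤i) = safe i N≤i

module _ {k n : ℕ} (A : TNCW k n) (E : Fin n → Fin k → Fin n → Bool) (allowed : AllowedSet A E) where

  private
    B : TNCW k n
    B = extend A E

  extend-preserves-ᾱ : ∀ {q σ t} → T (Δ A q σ t) → ¬ T (α A q σ t) → ¬ T (α B q σ t)
  extend-preserves-ᾱ {q} {σ} {t} q→t ᾱ qαt with Equivalence.to (T-∨ {α A q σ t} {E q σ t}) qαt
  ... | inj₁ a = ᾱ a
  ... | inj₂ e = proj₁ (allowed q σ t e) q→t

  extend-reflects-ᾱ : ∀ {q σ t} → T (Δ B q σ t) → ¬ T (α B q σ t) → T (Δ A q σ t) × ¬ T (α A q σ t)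
  extend-reflects-ᾱ {q} {σ} {t} q→t ᾱ with Equivalence.to (T-∨ {Δ A q σ t} {E q σ t}) q→t
  ... | inj₁ d = d , ᾱ ∘ ∨-introˡ (E q σ t)
  ... | inj₂ e = ⊥-elim (ᾱ (∨-introʳ (α A q σ t) (E q σ t) e))

  Lang⇒Lang-extend : ∀ q w → Lang (A ^ q) w → Lang (B ^ q) w
  Lang⇒Lang-extend q w (r , (r₀ , steps) , N , safe) =
    r , (r₀ , ∨-introˡ _ ∘ steps) , N , λ i N≤i → extend-preserves-ᾱ (steps i) (safe i N≤i)

  Lang-extend⇒Lang : ∀ q w → Lang (B ^ q) w → Lang (A ^ q) w
  Lang-extend⇒Lang q w (r , (r₀ , steps) , N , safe) =
    subst (λ q → Lang (A ^ q) w) r₀ (from N w r steps safe)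
    where
    from : ∀ N w r → Steps B w r → SafeFrom B N w r → Lang (A ^ r 0) w
    from zero w r steps safe =
      r , (refl , λ i → proj₁ (safeStep i)) , 0 , λ i _ → proj₂ (safeStep i)
      where
      safeStep : ∀ i → T (Δ A (r i) (w i) (r (suc i))) × ¬ T (α A (r i) (w i) (r (suc i)))
      safeStep i = extend-reflects-ᾱ (steps i) (safe i z≤n)
    from (suc N) w r steps safe
      with from N (w ∘ suc) (r ∘ suc) (steps ∘ suc) (λ i → safe (suc i) ∘ s≤s)
         | Equivalence.to (T-∨ {Δ A (r 0) (w 0) (r 1)} {E (r 0) (w 0) (r 1)}) (steps 0)
    ... | tail | inj₁ r₀→r₁ = Lang-∷ A w r₀→r₁ tail
    ... | tail | inj₂ e with proj₂ (allowed (r 0) (w 0) (r 1) e)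
    ... | t′ , r₁∼t′ , r₀→t′ = Lang-∷ A w r₀→t′ (proj₁ (r₁∼t′ (w ∘ suc)) tail)

  GFG-extend : ∀ q → GFG (A ^ q) → GFG (B ^ q)
  GFG-extend q (f , f[] , f-steps , f-wins) = f , f[] , ∨-introˡ _ ∘₂ f-steps , wins
    where
    wins : ∀ w → Lang (B ^ q) w → Accepting (B ^ q) w (f ∘ prefix {n = n} w)
    wins w L with f-wins w (Lang-extend⇒Lang q w L)
    ... | N , safe = N , λ i N≤i → extend-preserves-ᾱ (f-steps (prefix {n = n} w i) (w i)) (safe i N≤i)

proposition4p9 : ∀ {k n : ℕ} (A : TNCW k n) (E : Fin n → Fin k → Fin n → Bool)
                 → Nice A → AllowedSet A E → (p s : Fin n) → Equiv A p s
                 → GFG (extend A E ^ s) × SameLang (extend A E ^ s) (A ^ p)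
proposition4p9 A E (_ , _ , gfgStates , _) allowed p s p∼s =
  GFG-extend A E allowed s (gfgStates s) ,
  λ w → (proj₂ (p∼s w) ∘ Lang-extend⇒Lang A E allowed s w) ,
        (Lang⇒Lang-extend A E allowed s w ∘ proj₁ (p∼s w))
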